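{- Let $3\le s\le r$ and $t\ge 1$ be integers. Then there is no $t$-PDDS$[P_s\square P_r]$ in $\Lambda_2$.
   Context: $\Lambda_2$ is the infinite graph with vertex set $\mathbb{Z}^2$ in which two vertices are adjacent iff their Euclidean distance is $1$; $d$ denotes graph distance. For $S$ a set of vertices, $[S]$ is the induced subgraph and $d(v,C)=\min\{d(v,w):w\in C\}$. For $t\ge1$, $S$ is a $t$-perfect distance-dominating set ($t$-PDDS) if for each vertex $v$ there is a unique component $C_v$ of $[S]$ with $d(v,C_v)\le t$, and there is in $C_v$ a unique vertex $w$ with $d(v,w)=d(v,C_v)$. A $t$-PDDS$[H]$ is a $t$-PDDS all of whose components are isomorphic to the fixed finite graph $H$. $P_k$ is the path on $k$ vertices and $\square$ is the Cartesian product of graphs. -}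

module Defs where

open import Data.Nat using (ℕ; zero; suc; _+_; _≤_)
open import Data.Integer using (ℤ; ∣_∣; _-_)
open import Data.Fin using (Fin; toℕ)
open import Data.Product using (_×_; _,_; Σ; ∃; ∃-syntax)
open import Data.Sum using (_⊎_)
open import Relation.Binary.PropositionalEquality using (_≡_)
open import Relation.Nullary using (¬_)

V : Set
V = ℤ × ℤ

-- Graph distance in Λ₂ (the ℓ¹ / Manhattan distance on ℤ²).
d : V → V → ℕ
d (x , y) (x' , y') = ∣ x - x' ∣ + ∣ y - y' ∣

Adj : V → V → Set
Adj v w = d v w ≡ 1

VSet : Set₁
VSet = V → Set

-- Connectivity in the induced subgraph [S]: a walk inside S from v to w.
data Reach (S : VSet) : V → V → Set where
  here : ∀ {v} → S v → Reach S v v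
  step : ∀ {v u w} → S v → Adj v u → Reach S u w → Reach S v w

-- The component of [S] containing u ∈ S is the predicate  Reach S u.

PathAdj : {k : ℕ} → Fin k → Fin k → Set
PathAdj a b = (suc (toℕ a) ≡ toℕ b) ⊎ (suc (toℕ b) ≡ toℕ a)

GridAdj : {s r : ℕ} → Fin s × Fin r → Fin s × Fin r → Set
GridAdj (a , b) (a' , b') = (a ≡ a' × PathAdj b b') ⊎ (PathAdj a a' × b ≡ b')

ComponentIsoGrid : (s r : ℕ) (S : VSet) (u : V) → Set
ComponentIsoGrid s r S u =
  Σ (Fin s × Fin r → V) λ f →
      (∀ p → Reach S u (f p))
    × (∀ v → Reach S u v → ∃[ p ] f p ≡ v)
    × (∀ p q → f p ≡ f q → p ≡ q)
    × (∀ p q → (Adj (f p) (f q) → GridAdj p q) × (GridAdj p q → Adj (f p) (f q)))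

UniqueClosest : (S : VSet) (u v w : V) → Set
UniqueClosest S u v w =
    Reach S u w
  × (∀ w' → Reach S u w' → d v w ≤ d v w')
  × (∀ w' → Reach S u w' → d v w' ≡ d v w → w' ≡ w)

PDDS : ℕ → VSet → Set
PDDS t S = ∀ v →
  Σ V λ u →
      S u × (∃[ w ] (Reach S u w × d v w ≤ t))
    × (∀ u' → S u' → (∃[ w ] (Reach S u' w × d v w ≤ t)) → Reach S u u')
                                                         -- C_v unique
    × (∃[ w ] UniqueClosest S u v w)

PDDS[Grid] : ℕ → ℕ → ℕ → VSet → Set
PDDS[Grid] t s r S = PDDS t S × (∀ u → S u → ComponentIsoGrid s r S u)

-- Every component of S is an axis-parallel box with both sides of length at least 2: an
-- adjacency-preserving injection of P_s □ P_r into ℤ² is forced, unit square by unit square,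
-- to be affine along two perpendicular unit vectors. In a t-PDDS, vertices of S at distance
-- at most 2t lie in one component (a midpoint sees only one component within t), so distinct
-- components are more than 2t apart.
--
-- Fix a box R with lower-left corner c. The t + 2 points p_k = c - (k , t + 1 - k) are at
-- distance t + 1 from R, so their nearest components are not R; the witnesses w_k of those
-- components, being more than 2t away from c, c + (1,0), c + (0,1) and c + (1,1), sit exactly
-- t beyond p_k, at distance 2t + 1 from c. Consecutive witnesses are at most 2t apart, except
-- when they are exactly 2t + 2 apart; then one of them lies on the side of its box facing c,
-- so that box extends two steps away from c, to within 2t of the other witness. Hence all w_k
-- lie in a single box, which then contains the point with the x-coordinate of w_0 and the
-- y-coordinate of w_(t+1). That point is within 2t of c, so the box is R: a contradiction.
module Submission where

open import Defs
open import Data.Nat using (ℕ; _≤_)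
open import Relation.Nullary using (¬_)

open import Algebra.Bundles using (AbelianGroup)
open import Data.Empty using (⊥; ⊥-elim)
open import Data.Fin using (Fin; zero; suc; toℕ; fromℕ<)
import Data.Fin.Properties as Fin
open import Data.Integer as ℤ using (ℤ; +_; -[1+_]; ∣_∣; _⊖_)
  renaming (_+_ to _+ᶻ_; _-_ to _-ᶻ_; _*_ to _*ᶻ_)
import Data.Integer.Properties as ℤ
open import Data.Integer.Tactic.RingSolver using (solve-∀)
open import Data.Nat as ℕ using (zero; suc; _+_; _∸_; _<_; z≤n; s≤s)
import Data.Nat.Properties as ℕ
import Data.Nat.Tactic.RingSolver as ℕ-Solver
open import Data.Product using (_×_; _,_; proj₁; proj₂; ∃-syntax; swap)
open import Data.Product.Properties using (≡-dec)
open import Data.Sum using (_⊎_; inj₁; inj₂)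
open import Data.Vec using (_∷_; []; lookup)
open import Relation.Binary.PropositionalEquality
open import Relation.Nullary using (yes; no)
open import Relation.Nullary.Decidable using (Dec; from-yes; ¬?; _×-dec_; _⊎-dec_; _→-dec_)

open import Algebra.Properties.Group (AbelianGroup.group ℤ.+-0-abelianGroup) using (∙-cancelˡ)
open import Algebra.Properties.CommutativeSemigroup ℕ.+-commutativeSemigroup
  using () renaming (interchange to +-interchange)

-- Unit steps in ℤ²

infixl 6 _⊕_
_⊕_ : V → V → V
(a , b) ⊕ (c , e) = (a +ᶻ c , b +ᶻ e)

0ᵛ : V
0ᵛ = (+ 0 , + 0)

⊕-assoc : ∀ u v w → u ⊕ v ⊕ w ≡ u ⊕ (v ⊕ w)
⊕-assoc (a , b) (c , e) (f , g) = cong₂ _,_ (ℤ.+-assoc a c f) (ℤ.+-assoc b e g)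

⊕-comm : ∀ u v → u ⊕ v ≡ v ⊕ u
⊕-comm (a , b) (c , e) = cong₂ _,_ (ℤ.+-comm a c) (ℤ.+-comm b e)

⊕-identityʳ : ∀ u → u ⊕ 0ᵛ ≡ u
⊕-identityʳ (a , b) = cong₂ _,_ (ℤ.+-identityʳ a) (ℤ.+-identityʳ b)

⊕-cancelˡ : ∀ u v w → u ⊕ v ≡ u ⊕ w → v ≡ w
⊕-cancelˡ (a , b) (c , e) (f , g) eq =
  cong₂ _,_ (∙-cancelˡ a c f (cong proj₁ eq)) (∙-cancelˡ b e g (cong proj₂ eq))

⊕-cancel-0 : ∀ x u v → u ⊕ v ≡ 0ᵛ → x ⊕ u ⊕ v ≡ x
⊕-cancel-0 x u v u⊕v≡0 = trans (⊕-assoc x u v) (trans (cong (x ⊕_) u⊕v≡0) (⊕-identityʳ x))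

⊕-swapʳ : ∀ u v w → u ⊕ v ⊕ w ≡ u ⊕ w ⊕ v
⊕-swapʳ u v w = trans (⊕-assoc u v w) (trans (cong (u ⊕_) (⊕-comm v w)) (sym (⊕-assoc u w v)))

difference : ∀ p q → ∃[ v ] q ≡ p ⊕ v
difference (x , y) (x' , y') = (x' -ᶻ x , y' -ᶻ y) , cong₂ _,_ (lemma x x') (lemma y y')
  where
  lemma : ∀ i j → j ≡ i +ᶻ (j -ᶻ i)
  lemma = solve-∀

infix 4 _≟ᵛ_
_≟ᵛ_ : (u v : V) → Dec (u ≡ v)
_≟ᵛ_ = ≡-dec ℤ._≟_ ℤ._≟_

unit : Fin 4 → V
unit = lookup ((+ 1 , + 0) ∷ (-[1+ 0 ] , + 0) ∷ (+ 0 , + 1) ∷ (+ 0 , -[1+ 0 ]) ∷ [])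

Perp : Fin 4 → Fin 4 → Set
Perp a b = unit a ≢ unit b × unit a ⊕ unit b ≢ 0ᵛ

perp? : ∀ a b → Dec (Perp a b)
perp? a b = ¬? (unit a ≟ᵛ unit b) ×-dec ¬? (unit a ⊕ unit b ≟ᵛ 0ᵛ)

perp-sym : ∀ {a b} → Perp a b → Perp b a
perp-sym {a} {b} (a≢b , a⊕b≢0) =
  (λ b≡a → a≢b (sym b≡a)) , (λ b⊕a≡0 → a⊕b≢0 (trans (⊕-comm (unit a) (unit b)) b⊕a≡0))

Horizontal Vertical : V → Set
Horizontal v = ∣ proj₁ v ∣ ≡ 1 × proj₂ v ≡ + 0
Vertical v = proj₁ v ≡ + 0 × ∣ proj₂ v ∣ ≡ 1

-- Opaque: unfolding these exhaustive decision procedures is very expensive.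
opaque
  unit-sum-injective : ∀ a b c e → unit a ⊕ unit b ≡ unit c ⊕ unit e → unit a ⊕ unit b ≢ 0ᵛ →
    (unit a ≡ unit c × unit b ≡ unit e) ⊎ (unit a ≡ unit e × unit b ≡ unit c)
  unit-sum-injective = from-yes (Fin.all? λ a → Fin.all? λ b → Fin.all? λ c → Fin.all? λ e →
    (unit a ⊕ unit b ≟ᵛ unit c ⊕ unit e) →-dec (¬? (unit a ⊕ unit b ≟ᵛ 0ᵛ) →-dec
    ((unit a ≟ᵛ unit c ×-dec unit b ≟ᵛ unit e) ⊎-dec (unit a ≟ᵛ unit e ×-dec unit b ≟ᵛ unit c))))

  perp-unique : ∀ a b c → Perp a b → Perp c b → unit a ⊕ unit c ≢ 0ᵛ → unit c ≡ unit a
  perp-unique = from-yes (Fin.all? λ a → Fin.all? λ b → Fin.all? λ c →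
    perp? a b →-dec (perp? c b →-dec (¬? (unit a ⊕ unit c ≟ᵛ 0ᵛ) →-dec (unit c ≟ᵛ unit a))))

  perp-axes : ∀ a b → Perp a b →
    (Horizontal (unit a) × Vertical (unit b)) ⊎ (Vertical (unit a) × Horizontal (unit b))
  perp-axes = from-yes (Fin.all? λ a → Fin.all? λ b → perp? a b →-dec
    ((horizontal? (unit a) ×-dec vertical? (unit b)) ⊎-dec (vertical? (unit a) ×-dec horizontal? (unit b))))
    where
    horizontal? : ∀ v → Dec (Horizontal v)
    horizontal? (x , y) = ∣ x ∣ ℕ.≟ 1 ×-dec y ℤ.≟ + 0
    vertical? : ∀ v → Dec (Vertical v)
    vertical? (x , y) = x ℤ.≟ + 0 ×-dec ∣ y ∣ ℕ.≟ 1

-- The ℓ¹ metric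

∣i-i∣≡0 : ∀ i → ∣ i -ᶻ i ∣ ≡ 0
∣i-i∣≡0 i = cong ∣_∣ (ℤ.+-inverseʳ i)

∣i-[i+j]∣≡∣j∣ : ∀ i j → ∣ i -ᶻ (i +ᶻ j) ∣ ≡ ∣ j ∣
∣i-[i+j]∣≡∣j∣ i j = trans (cong ∣_∣ (lemma i j)) (ℤ.∣-i∣≡∣i∣ j)
  where
  lemma : ∀ i j → i -ᶻ (i +ᶻ j) ≡ ℤ.- j
  lemma = solve-∀

norm : V → ℕ
norm (x , y) = ∣ x ∣ + ∣ y ∣

d-⊕ : ∀ p v → d p (p ⊕ v) ≡ norm v
d-⊕ (x , y) (v , w) = cong₂ _+_ (∣i-[i+j]∣≡∣j∣ x v) (∣i-[i+j]∣≡∣j∣ y w)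

d-sym : ∀ p q → d p q ≡ d q p
d-sym (x , y) (x' , y') = cong₂ _+_ (ℤ.∣i-j∣≡∣j-i∣ x x') (ℤ.∣i-j∣≡∣j-i∣ y y')

norm-1⇒unit : ∀ v → norm v ≡ 1 → ∃[ a ] v ≡ unit a
norm-1⇒unit (+ 1 , + 0) _ = zero , refl
norm-1⇒unit (-[1+ 0 ] , + 0) _ = suc zero , refl
norm-1⇒unit (+ 0 , + 1) _ = suc (suc zero) , refl
norm-1⇒unit (+ 0 , -[1+ 0 ]) _ = suc (suc (suc zero)) , refl
norm-1⇒unit (+ 0 , + 0) ()
norm-1⇒unit (+ 0 , + suc (suc _)) ()
norm-1⇒unit (+ 0 , -[1+ suc _ ]) ()
norm-1⇒unit (+ 1 , + suc _) ()
norm-1⇒unit (+ 1 , -[1+ _ ]) ()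
norm-1⇒unit (-[1+ 0 ] , + suc _) ()
norm-1⇒unit (-[1+ 0 ] , -[1+ _ ]) ()
norm-1⇒unit (+ suc (suc _) , _) ()
norm-1⇒unit (-[1+ suc _ ] , _) ()

adj⇒unit : ∀ p q → Adj p q → ∃[ a ] q ≡ p ⊕ unit a
adj⇒unit p q adj with difference p q
... | v , refl with norm-1⇒unit v (trans (sym (d-⊕ p v)) adj)
...   | a , v≡a = a , cong (p ⊕_) v≡a

common-neighbour : ∀ x a b w → Adj (x ⊕ unit a) w → Adj (x ⊕ unit b) w → unit a ≢ unit b → w ≢ x →
  w ≡ x ⊕ unit a ⊕ unit b
common-neighbour x a b w adjᵃ adjᵇ a≢b w≢x with adj⇒unit (x ⊕ unit a) w adjᵃ | adj⇒unit (x ⊕ unit b) w adjᵇ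
... | c , w≡x+a+c | e , w≡x+b+e
  with unit-sum-injective a c b e sums-equal (λ a⊕c≡0 → w≢x (trans w≡x+a+c (⊕-cancel-0 x (unit a) (unit c) a⊕c≡0)))
  where
  sums-equal : unit a ⊕ unit c ≡ unit b ⊕ unit e
  sums-equal = ⊕-cancelˡ x _ _ (trans (sym (⊕-assoc x (unit a) (unit c)))
                 (trans (sym w≡x+a+c) (trans w≡x+b+e (⊕-assoc x (unit b) (unit e)))))
... | inj₁ (a≡b , _) = ⊥-elim (a≢b a≡b)
... | inj₂ (_ , c≡b) = trans w≡x+a+c (cong (x ⊕ unit a ⊕_) c≡b)

between : ∀ x v m → m ≤ ∣ v ∣ → ∃[ z ] ∣ x -ᶻ z ∣ ≡ m × ∣ z -ᶻ (x +ᶻ v) ∣ ≡ ∣ v ∣ ∸ m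
between x (+ n) m m≤n = x +ᶻ + m , ∣i-[i+j]∣≡∣j∣ x (+ m) , (begin
  ∣ (x +ᶻ + m) -ᶻ (x +ᶻ + n) ∣  ≡⟨ cong ∣_∣ (lemma x (+ m) (+ n)) ⟩
  ∣ + m -ᶻ + n ∣                ≡⟨ cong ∣_∣ (ℤ.m-n≡m⊖n m n) ⟩
  ∣ m ⊖ n ∣                     ≡⟨ ℤ.∣⊖∣-≤ m≤n ⟩
  n ∸ m                         ∎)
  where
  open ≡-Reasoning
  lemma : ∀ x i j → (x +ᶻ i) -ᶻ (x +ᶻ j) ≡ i -ᶻ j
  lemma = solve-∀
between x -[1+ n ] m m≤n = x -ᶻ + m , trans (∣i-[i+j]∣≡∣j∣ x (ℤ.- + m)) (ℤ.∣-i∣≡∣i∣ (+ m)) , (begin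
  ∣ (x -ᶻ + m) -ᶻ (x +ᶻ -[1+ n ]) ∣  ≡⟨ cong ∣_∣ (lemma x (+ m) -[1+ n ]) ⟩
  ∣ + suc n -ᶻ + m ∣                 ≡⟨ cong ∣_∣ (ℤ.m-n≡m⊖n (suc n) m) ⟩
  ∣ suc n ⊖ m ∣                      ≡⟨ cong ∣_∣ (ℤ.⊖-≥ m≤n) ⟩
  suc n ∸ m                          ∎)
  where
  open ≡-Reasoning
  lemma : ∀ x i j → (x -ᶻ i) -ᶻ (x +ᶻ j) ≡ ℤ.- j -ᶻ i
  lemma = solve-∀

geodesic : ∀ p v m → m ≤ norm v → ∃[ r ] d p r ≡ m × d r (p ⊕ v) ≡ norm v ∸ m
geodesic (x , y) (v , w) m m≤∣v∣+∣w∣ with m ℕ.≤? ∣ v ∣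
... | yes m≤∣v∣ with between x v m m≤∣v∣
...   | z , xz , zv = (z , y) ,
        trans (cong₂ _+_ xz (∣i-i∣≡0 y)) (ℕ.+-identityʳ m) ,
        trans (cong₂ _+_ zv (∣i-[i+j]∣≡∣j∣ y w)) (sym (ℕ.+-∸-comm ∣ w ∣ m≤∣v∣))
geodesic (x , y) (v , w) m m≤∣v∣+∣w∣ | no m≰∣v∣
  with between y w (m ∸ ∣ v ∣) (ℕ.m≤n+o⇒m∸n≤o m ∣ v ∣ m≤∣v∣+∣w∣)
... | z , yz , zw = (x +ᶻ v , z) ,
        trans (cong₂ _+_ (∣i-[i+j]∣≡∣j∣ x v) yz) (ℕ.m+[n∸m]≡n ∣v∣≤m) ,
        trans (cong₂ _+_ (∣i-i∣≡0 (x +ᶻ v)) zw) (begin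
          ∣ w ∣ ∸ (m ∸ ∣ v ∣)                      ≡⟨ ℕ.[m+n]∸[m+o]≡n∸o ∣ v ∣ ∣ w ∣ (m ∸ ∣ v ∣) ⟨
          (∣ v ∣ + ∣ w ∣) ∸ (∣ v ∣ + (m ∸ ∣ v ∣)) ≡⟨ cong ((∣ v ∣ + ∣ w ∣) ∸_) (ℕ.m+[n∸m]≡n ∣v∣≤m) ⟩
          (∣ v ∣ + ∣ w ∣) ∸ m                      ∎)
  where
  open ≡-Reasoning
  ∣v∣≤m : ∣ v ∣ ≤ m
  ∣v∣≤m = ℕ.<⇒≤ (ℕ.≰⇒> m≰∣v∣)

midpoint : ∀ t p q → d p q ≤ t + t → ∃[ r ] d r p ≤ t × d r q ≤ t
midpoint t p q pq≤2t with difference p q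
... | v , refl with geodesic p v (norm v ∸ t) (ℕ.m∸n≤m (norm v) t)
...   | r , pr , rq = r ,
          subst (_≤ t) (sym (trans (d-sym r p) pr)) (ℕ.m≤n+o⇒m∸n≤o (norm v) t ∣v∣≤2t) ,
          subst (_≤ t) (sym rq) (ℕ.m≤n+o⇒m∸n≤o (norm v) (norm v ∸ t)
            (subst (norm v ≤_) (ℕ.+-comm t (norm v ∸ t)) (ℕ.m≤n+m∸n (norm v) t)))
  where
  ∣v∣≤2t : norm v ≤ t + t
  ∣v∣≤2t = subst (_≤ t + t) (d-⊕ p v) pq≤2t

-- Components of a distance-dominating set

module _ {S : VSet} where

  reach-source : ∀ {a b} → Reach S a b → S a
  reach-source (here sa) = sa
  reach-source (step sa _ _) = sa

  reach-target : ∀ {a b} → Reach S a b → S b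
  reach-target (here sb) = sb
  reach-target (step _ _ r) = reach-target r

  reach-trans : ∀ {a b c} → Reach S a b → Reach S b c → Reach S a c
  reach-trans (here _) r = r
  reach-trans (step sa adj r) r' = step sa adj (reach-trans r r')

  reach-adj : ∀ {a b} → S a → S b → Adj a b → Reach S a b
  reach-adj sa sb adj = step sa adj (here sb)

  reach-sym : ∀ {a b} → Reach S a b → Reach S b a
  reach-sym (here sa) = here sa
  reach-sym (step {a} {u} sa adj r) =
    reach-trans (reach-sym r) (reach-adj (reach-source r) sa (trans (d-sym u a) adj))

module _ {t : ℕ} {S : VSet} (P : PDDS t S) where

  covered : ∀ v → ∃[ w ] S w × d v w ≤ t
  covered v with P v
  ... | _ , _ , (w , u↝w , vw≤t) , _ = w , reach-target u↝w , vw≤t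

  close⇒reach : ∀ {a b} → S a → S b → d a b ≤ t + t → Reach S a b
  close⇒reach {a} {b} sa sb ab≤2t with midpoint t a b ab≤2t
  ... | r , ra≤t , rb≤t with P r
  ...   | _ , _ , _ , unique , _ =
    reach-trans (reach-sym (unique a sa (a , here sa , ra≤t))) (unique b sb (b , here sb , rb≤t))

  apart : ∀ {a b} → S a → S b → ¬ Reach S a b → t + t < d a b
  apart {a} {b} sa sb a↛b with d a b ℕ.≤? t + t
  ... | yes ab≤2t = ⊥-elim (a↛b (close⇒reach sa sb ab≤2t))
  ... | no ab≰2t = ℕ.≰⇒> ab≰2t

-- Grid embeddings

line : V → V → ℕ → V
line x e zero = x
line x e (suc n) = line x e n ⊕ e

line-⊕ : ∀ x v e n → line (x ⊕ v) e n ≡ line x e n ⊕ v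
line-⊕ x v e zero = refl
line-⊕ x v e (suc n) = trans (cong (_⊕ e) (line-⊕ x v e n)) (⊕-swapʳ (line x e n) v e)

record GridEmbedding (n m : ℕ) (G : ℕ → ℕ → V) : Set where
  field
    adjʰ : ∀ {i j} → suc i ≤ n → j ≤ m → Adj (G i j) (G (suc i) j)
    adjᵛ : ∀ {i j} → i ≤ n → suc j ≤ m → Adj (G i j) (G i (suc j))
    injective : ∀ {i j i' j'} → i ≤ n → j ≤ m → i' ≤ n → j' ≤ m → G i j ≡ G i' j' → i ≡ i' × j ≡ j'

transpose : ∀ {n m G} → GridEmbedding n m G → GridEmbedding m n (λ i j → G j i)
transpose g = record
  { adjʰ = λ i<m j≤n → adjᵛ j≤n i<m
  ; adjᵛ = λ i≤m j<n → adjʰ j<n i≤m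
  ; injective = λ i≤m j≤n i'≤m j'≤n eq → swap (injective j≤n i≤m j'≤n i'≤m eq)
  }
  where open GridEmbedding g

module _ {n m G} (g : GridEmbedding n m G) (1≤m : 1 ≤ m) (a b : Fin 4)
         (G₁₀ : G 1 0 ≡ G 0 0 ⊕ unit a) (G₀₁ : G 0 1 ≡ G 0 0 ⊕ unit b) (a⊥b : Perp a b) where
  open GridEmbedding g

  Rows : ℕ → Set
  Rows i = G i 0 ≡ line (G 0 0) (unit a) i × G i 1 ≡ line (G 0 0) (unit a) i ⊕ unit b

  second-row : 1 ≤ n → Rows 1
  second-row 1≤n = G₁₀ , common-neighbour (G 0 0) a b (G 1 1)
    (subst (λ z → Adj z (G 1 1)) G₁₀ (adjᵛ 1≤n 1≤m))
    (subst (λ z → Adj z (G 1 1)) G₀₁ (adjʰ 1≤n 1≤m))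
    (proj₁ a⊥b)
    (λ G₁₁≡G₀₀ → ℕ.1+n≢0 (proj₁ (injective 1≤n 1≤m z≤n z≤n G₁₁≡G₀₀)))

  next-row : ∀ {i} → suc (suc i) ≤ n → Rows i → Rows (suc i) → Rows (suc (suc i))
  next-row {i} i+2≤n (Gi0 , _) (Gi+1,0 , Gi+1,1)
    with adj⇒unit (line (G 0 0) (unit a) (suc i)) (G (suc (suc i)) 0) (subst (λ z → Adj z _) Gi+1,0 (adjʰ i+2≤n z≤n))
  ... | c , Gi+2,0 = trans Gi+2,0 (cong (X ⊕_) c≡a) , trans w≡X+c+b (cong (λ e → X ⊕ e ⊕ unit b) c≡a)
    where
    X : V
    X = line (G 0 0) (unit a) (suc i)
    i+1≤n : suc i ≤ n
    i+1≤n = ℕ.<⇒≤ i+2≤n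
    c≢b : unit c ≢ unit b
    c≢b c≡b = ℕ.1+n≢0 (sym (proj₂ (injective i+2≤n z≤n i+1≤n 1≤m
      (trans Gi+2,0 (trans (cong (X ⊕_) c≡b) (sym Gi+1,1))))))
    w≢X : G (suc (suc i)) 1 ≢ X
    w≢X w≡X = ℕ.1+n≢0 (proj₂ (injective i+2≤n 1≤m i+1≤n z≤n (trans w≡X (sym Gi+1,0))))
    w≡X+c+b : G (suc (suc i)) 1 ≡ X ⊕ unit c ⊕ unit b
    w≡X+c+b = common-neighbour X c b (G (suc (suc i)) 1)
      (subst (λ z → Adj z _) Gi+2,0 (adjᵛ i+2≤n 1≤m))
      (subst (λ z → Adj z _) Gi+1,1 (adjʰ i+2≤n 1≤m))
      c≢b w≢X
    c⊕b≢0 : unit c ⊕ unit b ≢ 0ᵛ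
    c⊕b≢0 c⊕b≡0 = w≢X (trans w≡X+c+b (⊕-cancel-0 X (unit c) (unit b) c⊕b≡0))
    a⊕c≢0 : unit a ⊕ unit c ≢ 0ᵛ
    a⊕c≢0 a⊕c≡0 = ℕ.m≢1+n+m i (sym (proj₁ (injective i+2≤n z≤n (ℕ.<⇒≤ i+1≤n) z≤n
      (trans Gi+2,0 (trans (⊕-cancel-0 (line (G 0 0) (unit a) i) (unit a) (unit c) a⊕c≡0) (sym Gi0))))))
    c≡a : unit c ≡ unit a
    c≡a = perp-unique a b c a⊥b (c≢b , c⊕b≢0) a⊕c≢0

  bottom-rows : ∀ {i} → i ≤ n → Rows i
  bottom-rows {zero} _ = refl , G₀₁
  bottom-rows {suc i} i<n = proj₂ (consecutive i i<n)
    where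
    consecutive : ∀ i → suc i ≤ n → Rows i × Rows (suc i)
    consecutive zero 1≤n = (refl , G₀₁) , second-row 1≤n
    consecutive (suc i) i+2≤n with consecutive i (ℕ.<⇒≤ i+2≤n)
    ... | rowᵢ , rowᵢ₊₁ = rowᵢ₊₁ , next-row i+2≤n rowᵢ rowᵢ₊₁

module _ {n m G} (g : GridEmbedding n m G) where
  open GridEmbedding g

  grid-affine : 1 ≤ n → 1 ≤ m → ∃[ a ] ∃[ b ] Perp a b ×
    (∀ {i j} → i ≤ n → j ≤ m → G i j ≡ line (line (G 0 0) (unit a) i) (unit b) j)
  grid-affine 1≤n 1≤m with adj⇒unit (G 0 0) (G 1 0) (adjʰ 1≤n z≤n) | adj⇒unit (G 0 0) (G 0 1) (adjᵛ z≤n 1≤m)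
  ... | a , G₁₀ | b , G₀₁ = a , b , a⊥b , fill
    where
    x₀ : V
    x₀ = G 0 0
    a≢b : unit a ≢ unit b
    a≢b a≡b = ℕ.1+n≢0 (proj₁ (injective 1≤n z≤n z≤n 1≤m (trans G₁₀ (trans (cong (x₀ ⊕_) a≡b) (sym G₀₁)))))
    G₁₁≢x₀ : G 1 1 ≢ x₀
    G₁₁≢x₀ G₁₁≡x₀ = ℕ.1+n≢0 (proj₁ (injective 1≤n 1≤m z≤n z≤n G₁₁≡x₀))
    a⊥b : Perp a b
    a⊥b = a≢b , λ a⊕b≡0 → G₁₁≢x₀ (trans
      (common-neighbour x₀ a b (G 1 1) (subst (λ z → Adj z _) G₁₀ (adjᵛ 1≤n 1≤m))
        (subst (λ z → Adj z _) G₀₁ (adjʰ 1≤n 1≤m)) a≢b G₁₁≢x₀)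
      (⊕-cancel-0 x₀ (unit a) (unit b) a⊕b≡0))
    fill : ∀ {i j} → i ≤ n → j ≤ m → G i j ≡ line (line x₀ (unit a) i) (unit b) j
    fill {zero} _ j≤m = proj₁ (bottom-rows (transpose g) 1≤n b a G₀₁ G₁₀ (perp-sym {a} {b} a⊥b) j≤m)
    fill {suc i} {zero} i<n _ = proj₁ (bottom-rows g 1≤m a b G₁₀ G₀₁ a⊥b i<n)
    fill {suc i} {suc j} i<n j<m =
      trans w≡x+a+b (sym (cong (_⊕ unit b) (line-⊕ (line x₀ (unit a) i) (unit a) (unit b) j)))
      where
      x : V
      x = line (line x₀ (unit a) i) (unit b) j
      w≡x+a+b : G (suc i) (suc j) ≡ x ⊕ unit a ⊕ unit b
      w≡x+a+b = common-neighbour x a b (G (suc i) (suc j))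
        (subst (λ z → Adj z _) (trans (fill i<n (ℕ.<⇒≤ j<m)) (line-⊕ (line x₀ (unit a) i) (unit a) (unit b) j))
          (adjᵛ i<n j<m))
        (subst (λ z → Adj z _) (fill (ℕ.<⇒≤ i<n) j<m) (adjʰ i<n j<m))
        a≢b
        (λ w≡x → ℕ.1+n≢n (proj₁ (injective i<n j<m (ℕ.<⇒≤ i<n) (ℕ.<⇒≤ j<m)
          (trans w≡x (sym (fill (ℕ.<⇒≤ i<n) (ℕ.<⇒≤ j<m)))))))

-- Boxes

line-coords : ∀ p e i → line p e i ≡ (proj₁ p +ᶻ + i *ᶻ proj₁ e , proj₂ p +ᶻ + i *ᶻ proj₂ e)
line-coords (x , y) (e , f) zero = sym (cong₂ _,_ (ℤ.+-identityʳ x) (ℤ.+-identityʳ y))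
line-coords (x , y) (e , f) (suc i) =
  trans (cong (_⊕ (e , f)) (line-coords (x , y) (e , f) i)) (cong₂ _,_ (lemma x (+ i) e) (lemma y (+ i) f))
  where
  lemma : ∀ x k e → (x +ᶻ k *ᶻ e) +ᶻ e ≡ x +ᶻ (+ 1 +ᶻ k) *ᶻ e
  lemma = solve-∀

line²-coords : ∀ p e f i j → line (line p e i) f j ≡
  (proj₁ p +ᶻ + i *ᶻ proj₁ e +ᶻ + j *ᶻ proj₁ f , proj₂ p +ᶻ + i *ᶻ proj₂ e +ᶻ + j *ᶻ proj₂ f)
line²-coords p e f i j = trans (line-coords (line p e i) f j)
  (cong (λ q → (proj₁ q +ᶻ + j *ᶻ proj₁ f , proj₂ q +ᶻ + j *ᶻ proj₂ f)) (line-coords p e i))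

+-*-zeroʳ : ∀ x k e → e ≡ + 0 → x +ᶻ k *ᶻ e ≡ x
+-*-zeroʳ x k e refl = trans (cong (x +ᶻ_) (ℤ.*-zeroʳ k)) (ℤ.+-identityʳ x)

Onto : (ℕ → ℤ) → ℕ → ℤ → Set
Onto f n x₀ = (∀ {i} → i ≤ n → ∃[ p ] p ≤ n × f i ≡ x₀ +ᶻ + p)
            × (∀ {p} → p ≤ n → ∃[ i ] i ≤ n × f i ≡ x₀ +ᶻ + p)

unit-steps-onto : ∀ x e n → ∣ e ∣ ≡ 1 → ∃[ x₀ ] Onto (λ i → x +ᶻ + i *ᶻ e) n x₀
unit-steps-onto x (+ 1) n _ = x , (λ {i} i≤n → i , i≤n , forward i) , (λ {p} p≤n → p , p≤n , forward p)
  where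
  forward : ∀ i → x +ᶻ + i *ᶻ + 1 ≡ x +ᶻ + i
  forward i = cong (x +ᶻ_) (ℤ.*-identityʳ (+ i))
unit-steps-onto x -[1+ 0 ] n _ =
  x -ᶻ + n , (λ {i} i≤n → n ∸ i , ℕ.m∸n≤m n i , reflect i≤n) , (λ {p} p≤n → n ∸ p , ℕ.m∸n≤m n p , reflect′ p≤n)
  where
  backward : ∀ i → x +ᶻ + i *ᶻ -[1+ 0 ] ≡ x -ᶻ + i
  backward i = cong (x +ᶻ_) (trans (ℤ.*-comm (+ i) -[1+ 0 ]) (ℤ.-1*i≡-i (+ i)))
  lemma : ∀ x i j → x -ᶻ i ≡ (x -ᶻ (i +ᶻ j)) +ᶻ j
  lemma = solve-∀
  reflect : ∀ {i} → i ≤ n → x +ᶻ + i *ᶻ -[1+ 0 ] ≡ (x -ᶻ + n) +ᶻ + (n ∸ i)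
  reflect {i} i≤n = trans (backward i) (trans (lemma x (+ i) (+ (n ∸ i)))
    (cong (λ k → (x -ᶻ + k) +ᶻ + (n ∸ i)) (ℕ.m+[n∸m]≡n i≤n)))
  reflect′ : ∀ {p} → p ≤ n → x +ᶻ + (n ∸ p) *ᶻ -[1+ 0 ] ≡ (x -ᶻ + n) +ᶻ + p
  reflect′ {p} p≤n = trans (backward (n ∸ p)) (trans (lemma x (+ (n ∸ p)) (+ p))
    (cong (λ k → (x -ᶻ + k) +ᶻ + p) (trans (ℕ.+-comm (n ∸ p) p) (ℕ.m+[n∸m]≡n p≤n))))
unit-steps-onto x (+ 0) n ()
unit-steps-onto x (+ suc (suc _)) n ()
unit-steps-onto x -[1+ suc _ ] n ()

record IsBox (C : V → Set) : Set where
  field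
    x₀ y₀ : ℤ
    width height : ℕ
    2≤width : 2 ≤ width
    2≤height : 2 ≤ height
    inside : ∀ {z} → C z → ∃[ p ] ∃[ q ] p ≤ width × q ≤ height × z ≡ (x₀ +ᶻ + p , y₀ +ᶻ + q)
    full : ∀ {p q} → p ≤ width → q ≤ height → C (x₀ +ᶻ + p , y₀ +ᶻ + q)

product-box : ∀ {C : V → Set} {f g : ℕ → ℤ} {n m} → 2 ≤ n → 2 ≤ m →
  ∃[ x₀ ] Onto f n x₀ → ∃[ y₀ ] Onto g m y₀ →
  (∀ {z} → C z → ∃[ i ] ∃[ j ] i ≤ n × j ≤ m × z ≡ (f i , g j)) →
  (∀ {i j} → i ≤ n → j ≤ m → C (f i , g j)) → IsBox C
product-box {C} {f} {g} {n} {m} 2≤n 2≤m (x₀ , f-into , f-onto) (y₀ , g-into , g-onto) C⊆image image⊆C = record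
  { x₀ = x₀ ; y₀ = y₀ ; width = n ; height = m ; 2≤width = 2≤n ; 2≤height = 2≤m
  ; inside = inside ; full = full }
  where
  inside : ∀ {z} → C z → ∃[ p ] ∃[ q ] p ≤ n × q ≤ m × z ≡ (x₀ +ᶻ + p , y₀ +ᶻ + q)
  inside Cz with C⊆image Cz
  ... | i , j , i≤n , j≤m , z≡fg with f-into i≤n | g-into j≤m
  ...   | p , p≤n , fi | q , q≤m , gj = p , q , p≤n , q≤m , trans z≡fg (cong₂ _,_ fi gj)
  full : ∀ {p q} → p ≤ n → q ≤ m → C (x₀ +ᶻ + p , y₀ +ᶻ + q)
  full p≤n q≤m with f-onto p≤n | g-onto q≤m
  ... | i , i≤n , fi | j , j≤m , gj = subst C (cong₂ _,_ fi gj) (image⊆C i≤n j≤m)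

grid-box : ∀ {n m G} {C : V → Set} → GridEmbedding n m G → 2 ≤ n → 2 ≤ m →
  (∀ {z} → C z → ∃[ i ] ∃[ j ] i ≤ n × j ≤ m × G i j ≡ z) →
  (∀ {i j} → i ≤ n → j ≤ m → C (G i j)) → IsBox C
grid-box {n} {m} {G} {C} g 2≤n 2≤m C⊆G G⊆C =
  affine-box (grid-affine g (ℕ.≤-trans (s≤s z≤n) 2≤n) (ℕ.≤-trans (s≤s z≤n) 2≤m))
  where
  affine-box : (∃[ a ] ∃[ b ] Perp a b ×
    (∀ {i j} → i ≤ n → j ≤ m → G i j ≡ line (line (G 0 0) (unit a) i) (unit b) j)) → IsBox C
  affine-box (a , b , a⊥b , G-affine) = axes-box (perp-axes a b a⊥b)
    where
    p₁ p₂ a₁ a₂ b₁ b₂ : ℤ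
    p₁ = proj₁ (G 0 0)
    p₂ = proj₂ (G 0 0)
    a₁ = proj₁ (unit a)
    a₂ = proj₂ (unit a)
    b₁ = proj₁ (unit b)
    b₂ = proj₂ (unit b)
    coords : ∀ {i j} → i ≤ n → j ≤ m → G i j ≡ (p₁ +ᶻ + i *ᶻ a₁ +ᶻ + j *ᶻ b₁ , p₂ +ᶻ + i *ᶻ a₂ +ᶻ + j *ᶻ b₂)
    coords {i} {j} i≤n j≤m = trans (G-affine i≤n j≤m) (line²-coords (G 0 0) (unit a) (unit b) i j)
    axes-box : (Horizontal (unit a) × Vertical (unit b)) ⊎ (Vertical (unit a) × Horizontal (unit b)) → IsBox C
    axes-box (inj₁ ((∣a₁∣≡1 , a₂≡0) , (b₁≡0 , ∣b₂∣≡1))) =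
      product-box 2≤n 2≤m (unit-steps-onto p₁ a₁ n ∣a₁∣≡1) (unit-steps-onto p₂ b₂ m ∣b₂∣≡1)
        (λ Cz → let i , j , i≤n , j≤m , Gij≡z = C⊆G Cz in i , j , i≤n , j≤m , trans (sym Gij≡z) (coords′ i≤n j≤m))
        (λ i≤n j≤m → subst C (coords′ i≤n j≤m) (G⊆C i≤n j≤m))
      where
      coords′ : ∀ {i j} → i ≤ n → j ≤ m → G i j ≡ (p₁ +ᶻ + i *ᶻ a₁ , p₂ +ᶻ + j *ᶻ b₂)
      coords′ {i} {j} i≤n j≤m = trans (coords i≤n j≤m)
        (cong₂ _,_ (+-*-zeroʳ _ (+ j) b₁ b₁≡0) (cong (_+ᶻ + j *ᶻ b₂) (+-*-zeroʳ p₂ (+ i) a₂ a₂≡0)))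
    axes-box (inj₂ ((a₁≡0 , ∣a₂∣≡1) , (∣b₁∣≡1 , b₂≡0))) =
      product-box 2≤m 2≤n (unit-steps-onto p₁ b₁ m ∣b₁∣≡1) (unit-steps-onto p₂ a₂ n ∣a₂∣≡1)
        (λ Cz → let i , j , i≤n , j≤m , Gij≡z = C⊆G Cz in j , i , j≤m , i≤n , trans (sym Gij≡z) (coords′ i≤n j≤m))
        (λ j≤m i≤n → subst C (coords′ i≤n j≤m) (G⊆C i≤n j≤m))
      where
      coords′ : ∀ {i j} → i ≤ n → j ≤ m → G i j ≡ (p₁ +ᶻ + j *ᶻ b₁ , p₂ +ᶻ + i *ᶻ a₂)
      coords′ {i} {j} i≤n j≤m = trans (coords i≤n j≤m)
        (cong₂ _,_ (cong (_+ᶻ + j *ᶻ b₁) (+-*-zeroʳ p₁ (+ i) a₁ a₁≡0)) (+-*-zeroʳ _ (+ j) b₂ b₂≡0))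

module _ {n m : ℕ} (f : Fin (suc n) × Fin (suc m) → V) where

  -- The value 0ᵛ outside the index range is never used.
  on-ℕ : ℕ → ℕ → V
  on-ℕ i j with i ℕ.≤? n | j ℕ.≤? m
  ... | yes i≤n | yes j≤m = f (fromℕ< (s≤s i≤n) , fromℕ< (s≤s j≤m))
  ... | _ | _ = 0ᵛ

  on-ℕ-≡ : ∀ {i j} (i≤n : i ≤ n) (j≤m : j ≤ m) → on-ℕ i j ≡ f (fromℕ< (s≤s i≤n) , fromℕ< (s≤s j≤m))
  on-ℕ-≡ {i} {j} i≤n j≤m with i ℕ.≤? n | j ℕ.≤? m
  ... | yes _ | yes _ = refl
  ... | no i≰n | _ = ⊥-elim (i≰n i≤n)
  ... | yes _ | no j≰m = ⊥-elim (j≰m j≤m)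

  on-ℕ-embedding : (∀ p q → (Adj (f p) (f q) → GridAdj p q) × (GridAdj p q → Adj (f p) (f q))) →
    (∀ p q → f p ≡ f q → p ≡ q) → GridEmbedding n m on-ℕ
  on-ℕ-embedding f-adj f-injective = record { adjʰ = adjʰ ; adjᵛ = adjᵛ ; injective = injective }
    where
    successor : ∀ {i N} (i<N : suc i ≤ N) → PathAdj {suc N} (fromℕ< (s≤s (ℕ.<⇒≤ i<N))) (fromℕ< (s≤s i<N))
    successor i<N = inj₁ (trans (cong suc (Fin.toℕ-fromℕ< (s≤s (ℕ.<⇒≤ i<N)))) (sym (Fin.toℕ-fromℕ< (s≤s i<N))))
    adjʰ : ∀ {i j} → suc i ≤ n → j ≤ m → Adj (on-ℕ i j) (on-ℕ (suc i) j)
    adjʰ i<n j≤m rewrite on-ℕ-≡ (ℕ.<⇒≤ i<n) j≤m | on-ℕ-≡ i<n j≤m =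
      proj₂ (f-adj _ _) (inj₂ (successor i<n , refl))
    adjᵛ : ∀ {i j} → i ≤ n → suc j ≤ m → Adj (on-ℕ i j) (on-ℕ i (suc j))
    adjᵛ i≤n j<m rewrite on-ℕ-≡ i≤n (ℕ.<⇒≤ j<m) | on-ℕ-≡ i≤n j<m =
      proj₂ (f-adj _ _) (inj₁ (refl , successor j<m))
    index : ∀ {k l K} (k<K : k < K) (l<K : l < K) → fromℕ< k<K ≡ fromℕ< l<K → k ≡ l
    index k<K l<K eq = trans (sym (Fin.toℕ-fromℕ< k<K)) (trans (cong toℕ eq) (Fin.toℕ-fromℕ< l<K))
    injective : ∀ {i j i' j'} → i ≤ n → j ≤ m → i' ≤ n → j' ≤ m → on-ℕ i j ≡ on-ℕ i' j' → i ≡ i' × j ≡ j'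
    injective i≤n j≤m i'≤n j'≤m eq rewrite on-ℕ-≡ i≤n j≤m | on-ℕ-≡ i'≤n j'≤m =
      index (s≤s i≤n) (s≤s i'≤n) (cong proj₁ (f-injective _ _ eq)) ,
      index (s≤s j≤m) (s≤s j'≤m) (cong proj₂ (f-injective _ _ eq))

component-box : ∀ {s r S u} → 3 ≤ s → 3 ≤ r → ComponentIsoGrid s r S u → IsBox (Reach S u)
component-box {suc n} {suc m} {S} {u} (s≤s 2≤n) (s≤s 2≤m) (f , f-reach , f-onto , f-injective , f-adj) =
  grid-box (on-ℕ-embedding f f-adj f-injective) 2≤n 2≤m onto
    (λ i≤n j≤m → subst (Reach S u) (sym (on-ℕ-≡ f i≤n j≤m)) (f-reach _))
  where
  onto : ∀ {z} → Reach S u z → ∃[ i ] ∃[ j ] i ≤ n × j ≤ m × on-ℕ f i j ≡ z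
  onto u↝z with f-onto _ u↝z
  ... | (k , l) , fkl≡z = toℕ k , toℕ l , Fin.toℕ≤pred[n] k , Fin.toℕ≤pred[n] l ,
    trans (on-ℕ-≡ f (Fin.toℕ≤pred[n] k) (Fin.toℕ≤pred[n] l))
      (trans (cong₂ (λ k l → f (k , l)) (Fin.fromℕ<-toℕ k _) (Fin.fromℕ<-toℕ l _)) fkl≡z)

end-minus-two : ∀ x₀ {w p} → p ≤ w → 2 ≤ w → ¬ suc p ≤ w → ∃[ p' ] p' ≤ w × x₀ +ᶻ + p' ≡ (x₀ +ᶻ + p) -ᶻ + 2
end-minus-two x₀ {w} {p} p≤w 2≤w p≮w = p ∸ 2 , ℕ.≤-trans (ℕ.m∸n≤m p 2) p≤w ,
  trans (lemma x₀ (+ (p ∸ 2))) (cong (λ k → (x₀ +ᶻ + k) -ᶻ + 2) (ℕ.m+[n∸m]≡n 2≤p))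
  where
  2≤p : 2 ≤ p
  2≤p = subst (2 ≤_) (ℕ.≤-antisym (ℕ.≮⇒≥ p≮w) p≤w) 2≤w
  lemma : ∀ x k → x +ᶻ k ≡ (x +ᶻ (+ 2 +ᶻ k)) -ᶻ + 2
  lemma = solve-∀

+-suc-+1 : ∀ x p → x +ᶻ + suc p ≡ (x +ᶻ + p) +ᶻ + 1
+-suc-+1 x p = lemma x (+ p)
  where
  lemma : ∀ x k → x +ᶻ (+ 1 +ᶻ k) ≡ (x +ᶻ k) +ᶻ + 1
  lemma = solve-∀

module _ {C : V → Set} (B : IsBox C) where
  open IsBox B

  box-corner : ∀ {x y x' y'} → C (x , y) → C (x' , y') → C (x , y')
  box-corner Cxy Cx'y' with inside Cxy | inside Cx'y'
  ... | _ , _ , p≤w , _ , refl | _ , _ , _ , q'≤h , refl = full p≤w q'≤h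

  box-east-edge : ∀ {x y} → C (x , y) → ¬ C (x +ᶻ + 1 , y) → C (x -ᶻ + 2 , y)
  box-east-edge Cxy no-east with inside Cxy
  ... | p , q , p≤w , q≤h , refl with suc p ℕ.≤? width
  ...   | yes p<w = ⊥-elim (no-east (subst (λ x → C (x , _)) (+-suc-+1 x₀ p) (full p<w q≤h)))
  ...   | no p≮w with end-minus-two x₀ p≤w 2≤width p≮w
  ...     | p' , p'≤w , x≡ = subst (λ x → C (x , _)) x≡ (full p'≤w q≤h)

  box-north-edge : ∀ {x y} → C (x , y) → ¬ C (x , y +ᶻ + 1) → C (x , y -ᶻ + 2)
  box-north-edge Cxy no-north with inside Cxy
  ... | p , q , p≤w , q≤h , refl with suc q ℕ.≤? height
  ...   | yes q<h = ⊥-elim (no-north (subst (λ y → C (_ , y)) (+-suc-+1 y₀ q) (full p≤w q<h)))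
  ...   | no q≮h with end-minus-two y₀ q≤h 2≤height q≮h
  ...     | q' , q'≤h , y≡ = subst (λ y → C (_ , y)) y≡ (full p≤w q'≤h)

-- The corner argument

∣-[1+n]-k∣≡1+n+k : ∀ n k → ∣ -[1+ n ] -ᶻ + k ∣ ≡ suc n + k
∣-[1+n]-k∣≡1+n+k n zero = cong suc (sym (ℕ.+-identityʳ n))
∣-[1+n]-k∣≡1+n+k n (suc k) = cong suc (sym (ℕ.+-suc n k))

∣-[1+n]+1∣≡n : ∀ n → ∣ -[1+ n ] +ᶻ + 1 ∣ ≡ n
∣-[1+n]+1∣≡n zero = refl
∣-[1+n]+1∣≡n (suc n) = refl

beyond-or-detour : ∀ X k → (∃[ a ] X ≡ + (k + a)) ⊎ (∃[ e ] e ≤ 1 × ∣ X +ᶻ + e ∣ < ∣ X -ᶻ + k ∣ + k)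
beyond-or-detour (+ n) k with k ℕ.≤? n
... | yes k≤n = inj₁ (n ∸ k , cong +_ (sym (ℕ.m+[n∸m]≡n k≤n)))
... | no k≰n = inj₂ (0 , z≤n , (begin-strict
  ∣ + n +ᶻ + 0 ∣         ≡⟨ ℕ.+-identityʳ n ⟩
  n                      <⟨ n<k ⟩
  k                      ≤⟨ ℕ.m≤n+m k (k ∸ n) ⟩
  (k ∸ n) + k            ≡⟨ cong (_+ k) (trans (sym (ℤ.∣⊖∣-≤ (ℕ.<⇒≤ n<k))) (cong ∣_∣ (sym (ℤ.m-n≡m⊖n n k)))) ⟩
  ∣ + n -ᶻ + k ∣ + k     ∎))
  where
  open ℕ.≤-Reasoning
  n<k : n < k
  n<k = ℕ.≰⇒> k≰n
beyond-or-detour -[1+ n ] k = inj₂ (1 , ℕ.≤-refl , (begin-strict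
  ∣ -[1+ n ] +ᶻ + 1 ∣    ≡⟨ ∣-[1+n]+1∣≡n n ⟩
  n                      <⟨ ℕ.n<1+n n ⟩
  suc n                  ≤⟨ ℕ.m≤m+n (suc n) (k + k) ⟩
  suc n + (k + k)        ≡⟨ sym (ℕ.+-assoc (suc n) k k) ⟩
  (suc n + k) + k        ≡⟨ cong (_+ k) (sym (∣-[1+n]-k∣≡1+n+k n k)) ⟩
  ∣ -[1+ n ] -ᶻ + k ∣ + k ∎))
  where open ℕ.≤-Reasoning

∣i+0∣≤∣i-k∣+k : ∀ X k → ∣ X +ᶻ + 0 ∣ ≤ ∣ X -ᶻ + k ∣ + k
∣i+0∣≤∣i-k∣+k X k = subst (λ z → ∣ z ∣ ≤ ∣ X -ᶻ + k ∣ + k) (lemma X (+ k)) (ℤ.∣i+j∣≤∣i∣+∣j∣ (X -ᶻ + k) (+ k))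
  where
  lemma : ∀ X K → (X -ᶻ K) +ᶻ K ≡ X +ᶻ + 0
  lemma = solve-∀

∣k+a-k∣≡a : ∀ k a → ∣ + (k + a) -ᶻ + k ∣ ≡ a
∣k+a-k∣≡a k a = trans (ℤ.∣i-j∣≡∣j-i∣ (+ (k + a)) (+ k)) (∣i-[i+j]∣≡∣j∣ (+ k) (+ a))

within-budget : ∀ c k c' l {t A} → c + c' ≤ t → k + l ≡ suc t → A < (c + k) + (c' + l) → A ≤ t + t
within-budget c k c' l {t} {A} c+c'≤t k+l≡1+t A<budget = ℕ.≤-pred (begin
  suc A                    ≤⟨ A<budget ⟩
  (c + k) + (c' + l)       ≡⟨ +-interchange c k c' l ⟩
  (c + c') + (k + l)       ≤⟨ ℕ.+-mono-≤ c+c'≤t (ℕ.≤-reflexive k+l≡1+t) ⟩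
  t + suc t                ≡⟨ ℕ.+-suc t t ⟩
  suc (t + t)              ∎)
  where open ℕ.≤-Reasoning

-- X and Y are offsets towards the lower left from a corner c of a box; the far-hypotheses say
-- that the point is more than 2t away from c and from its three neighbours in the box.
corner-shape : ∀ t X Y k l → k + l ≡ suc t → ∣ X -ᶻ + k ∣ + ∣ Y -ᶻ + l ∣ ≤ t →
  (∀ {e f} → e ≤ 1 → f ≤ 1 → t + t < ∣ X +ᶻ + e ∣ + ∣ Y +ᶻ + f ∣) →
  ∃[ a ] ∃[ b ] a + b ≡ t × X ≡ + (k + a) × Y ≡ + (l + b)
corner-shape t X Y k l k+l≡1+t near far with beyond-or-detour X k | beyond-or-detour Y l
... | inj₂ (e , e≤1 , X-detour) | _ = ⊥-elim (ℕ.<⇒≱ (far e≤1 z≤n)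
  (within-budget (∣ X -ᶻ + k ∣) k (∣ Y -ᶻ + l ∣) l near k+l≡1+t (ℕ.+-mono-<-≤ X-detour (∣i+0∣≤∣i-k∣+k Y l))))
... | inj₁ _ | inj₂ (f , f≤1 , Y-detour) = ⊥-elim (ℕ.<⇒≱ (far z≤n f≤1)
  (within-budget (∣ X -ᶻ + k ∣) k (∣ Y -ᶻ + l ∣) l near k+l≡1+t (ℕ.+-mono-≤-< (∣i+0∣≤∣i-k∣+k X k) Y-detour)))
... | inj₁ (a , refl) | inj₁ (b , refl) = a , b , ℕ.≤-antisym a+b≤t t≤a+b , refl , refl
  where
  a+b≤t : a + b ≤ t
  a+b≤t = subst (_≤ t) (cong₂ _+_ (∣k+a-k∣≡a k a) (∣k+a-k∣≡a l b)) near
  t≤a+b : t ≤ a + b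
  t≤a+b = ℕ.+-cancelˡ-≤ t t (a + b) (ℕ.≤-pred (begin
    suc (t + t)                     ≤⟨ far z≤n z≤n ⟩
    ((k + a) + 0) + ((l + b) + 0)   ≡⟨ cong₂ _+_ (ℕ.+-identityʳ (k + a)) (ℕ.+-identityʳ (l + b)) ⟩
    (k + a) + (l + b)               ≡⟨ +-interchange k a l b ⟩
    (k + l) + (a + b)               ≡⟨ cong (_+ (a + b)) k+l≡1+t ⟩
    suc t + (a + b)                 ∎))
    where open ℕ.≤-Reasoning

adj-east : ∀ x y → Adj (x , y) (x +ᶻ + 1 , y)
adj-east x y = cong₂ _+_ (∣i-[i+j]∣≡∣j∣ x (+ 1)) (∣i-i∣≡0 y)

adj-north : ∀ x y → Adj (x , y) (x , y +ᶻ + 1)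
adj-north x y = cong₂ _+_ (∣i-i∣≡0 x) (∣i-[i+j]∣≡∣j∣ y (+ 1))

exchange : ∀ {a e a' b b'} → a + e ≡ a' → a + b ≡ a' + b' → b ≡ e + b'
exchange {a} {e} {_} {b} {b'} refl a+b≡ = ℕ.+-cancelˡ-≡ a b (e + b') (trans a+b≡ (ℕ.+-assoc a e b'))

extreme-gap : ∀ {t a b a' e} → a + b ≡ t → a' + e ≡ suc a → suc t ≤ e → a' ≡ 0 × a ≡ t
extreme-gap {t} {a} {b} {a'} {e} a+b≡t a'+e≡1+a 1+t≤e = a'≡0 , a≡t
  where
  a≤t : a ≤ t
  a≤t = ℕ.≤-trans (ℕ.m≤m+n a b) (ℕ.≤-reflexive a+b≡t)
  a≡t : a ≡ t
  a≡t = ℕ.≤-antisym a≤t (ℕ.≤-pred (ℕ.≤-trans 1+t≤e (subst (e ≤_) a'+e≡1+a (ℕ.m≤n+m e a'))))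
  a'≡0 : a' ≡ 0
  a'≡0 = ℕ.n≤0⇒n≡0 (ℕ.+-cancelʳ-≤ e a' 0 (ℕ.≤-trans (ℕ.≤-reflexive a'+e≡1+a) (ℕ.≤-trans (s≤s a≤t) 1+t≤e)))

module Corner {t : ℕ} {S : VSet} (1≤t : 1 ≤ t) (P : PDDS t S)
              (box : ∀ {u} → S u → IsBox (Reach S u)) {u₀ : V} (Su₀ : S u₀) where

  open IsBox (box Su₀) using (x₀; y₀; width; height; 2≤width; 2≤height; inside; full)

  R : V → Set
  R = Reach S u₀

  Outside : V → Set
  Outside z = S z × ¬ R z

  ne : ℕ → ℕ → V
  ne i j = (x₀ +ᶻ + i , y₀ +ᶻ + j)

  sw : ℕ → ℕ → V
  sw p q = (x₀ -ᶻ + p , y₀ -ᶻ + q)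

  d-sw-ne : ∀ p q i j → d (sw p q) (ne i j) ≡ (p + i) + (q + j)
  d-sw-ne p q i j = cong₂ _+_ (gap x₀ p i) (gap y₀ q j)
    where
    lemma : ∀ c P I → (c -ᶻ P) -ᶻ (c +ᶻ I) ≡ ℤ.- (P +ᶻ I)
    lemma = solve-∀
    gap : ∀ c p i → ∣ (c -ᶻ + p) -ᶻ (c +ᶻ + i) ∣ ≡ p + i
    gap c p i = trans (cong ∣_∣ (lemma c (+ p) (+ i))) (ℤ.∣-i∣≡∣i∣ (+ (p + i)))

  d-sw : ∀ {p q p' q' u v} → p' ≡ p + u → q ≡ q' + v → d (sw p q) (sw p' q') ≡ u + v
  d-sw {p} {_} {_} {q'} {u} {v} refl refl = cong₂ _+_ (cong ∣_∣ (lemma x₀ (+ p) (+ u)))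
    (trans (ℤ.∣i-j∣≡∣j-i∣ (y₀ -ᶻ + (q' + v)) (y₀ -ᶻ + q')) (cong ∣_∣ (lemma y₀ (+ q') (+ v))))
    where
    lemma : ∀ c P U → (c -ᶻ P) -ᶻ (c -ᶻ (P +ᶻ U)) ≡ U
    lemma = solve-∀

  near-corner : ∀ {z} → S z → d z (ne 0 0) ≤ t + t → R z
  near-corner {z} Sz near = reach-trans corner∈R
    (close⇒reach P (reach-target corner∈R) Sz (subst (_≤ t + t) (d-sym z (ne 0 0)) near))
    where
    corner∈R : R (ne 0 0)
    corner∈R = full z≤n z≤n

  far-from-R : ∀ {z} → Outside z → ∀ {i j} → i ≤ width → j ≤ height → t + t < d z (ne i j)
  far-from-R (Sz , z∉R) i≤w j≤h =
    apart P Sz (reach-target (full i≤w j≤h)) (λ z↝ne → z∉R (reach-trans (full i≤w j≤h) (reach-sym z↝ne)))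

  no-reach-back : ∀ {z z'} → Outside z → Adj z z' → d z' (ne 0 0) ≤ t + t → ¬ Reach S z z'
  no-reach-back {z} {z'} (Sz , z∉R) adj near z↝z' =
    z∉R (reach-trans (near-corner Sz' near) (reach-adj Sz' Sz (trans (d-sym z' z) adj)))
    where
    Sz' : S z'
    Sz' = reach-target z↝z'

  west-arm : ∀ {x y} → Outside (x , y) → d (x +ᶻ + 1 , y) (ne 0 0) ≤ t + t → Reach S (x , y) (x -ᶻ + 2 , y)
  west-arm {x} {y} z@(Sz , _) near = box-east-edge (box Sz) (here Sz) (no-reach-back z (adj-east x y) near)

  south-arm : ∀ {x y} → Outside (x , y) → d (x , y +ᶻ + 1) (ne 0 0) ≤ t + t → Reach S (x , y) (x , y -ᶻ + 2)
  south-arm {x} {y} z@(Sz , _) near = box-north-edge (box Sz) (here Sz) (no-reach-back z (adj-north x y) near)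

  W : ℕ → ℕ → V
  W k l = proj₁ (covered P (sw k l))

  W-near : ∀ k l → d (sw k l) (W k l) ≤ t
  W-near k l = proj₂ (proj₂ (covered P (sw k l)))

  W-outside : ∀ k l → k + l ≡ suc t → Outside (W k l)
  W-outside k l k+l≡1+t = proj₁ (proj₂ (covered P (sw k l))) , W∉R
    where
    W∉R : ¬ R (W k l)
    W∉R W∈R with inside W∈R
    ... | i , j , _ , _ , W≡ne = ℕ.<⇒≱ (begin
      suc t               ≡⟨ k+l≡1+t ⟨
      k + l               ≤⟨ ℕ.+-mono-≤ (ℕ.m≤m+n k i) (ℕ.m≤m+n l j) ⟩
      (k + i) + (l + j)   ≡⟨ d-sw-ne k l i j ⟨
      d (sw k l) (ne i j) ≡⟨ cong (d (sw k l)) W≡ne ⟨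
      d (sw k l) (W k l)  ∎) (W-near k l)
      where open ℕ.≤-Reasoning

  W-shape : ∀ k l → k + l ≡ suc t → ∃[ a ] ∃[ b ] a + b ≡ t × W k l ≡ sw (k + a) (l + b)
  W-shape k l k+l≡1+t with corner-shape t (x₀ -ᶻ wx) (y₀ -ᶻ wy) k l k+l≡1+t near far
    where
    wx wy : ℤ
    wx = proj₁ (W k l)
    wy = proj₂ (W k l)
    reorder : ∀ c w K → (c -ᶻ K) -ᶻ w ≡ (c -ᶻ w) -ᶻ K
    reorder = solve-∀
    mirror : ∀ c w e → w -ᶻ (c +ᶻ e) ≡ ℤ.- ((c -ᶻ w) +ᶻ e)
    mirror = solve-∀
    near : ∣ (x₀ -ᶻ wx) -ᶻ + k ∣ + ∣ (y₀ -ᶻ wy) -ᶻ + l ∣ ≤ t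
    near = subst (_≤ t) (cong₂ (λ X Y → ∣ X ∣ + ∣ Y ∣) (reorder x₀ wx (+ k)) (reorder y₀ wy (+ l))) (W-near k l)
    offset : ∀ c w e → ∣ w -ᶻ (c +ᶻ + e) ∣ ≡ ∣ (c -ᶻ w) +ᶻ + e ∣
    offset c w e = trans (cong ∣_∣ (mirror c w (+ e))) (ℤ.∣-i∣≡∣i∣ ((c -ᶻ w) +ᶻ + e))
    ≤1⇒≤ : ∀ {e w} → e ≤ 1 → 2 ≤ w → e ≤ w
    ≤1⇒≤ e≤1 2≤w = ℕ.≤-trans e≤1 (ℕ.≤-trans (s≤s z≤n) 2≤w)
    far : ∀ {e f} → e ≤ 1 → f ≤ 1 → t + t < ∣ (x₀ -ᶻ wx) +ᶻ + e ∣ + ∣ (y₀ -ᶻ wy) +ᶻ + f ∣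
    far {e} {f} e≤1 f≤1 = subst (t + t <_) (cong₂ _+_ (offset x₀ wx e) (offset y₀ wy f))
      (far-from-R (W-outside k l k+l≡1+t) (≤1⇒≤ e≤1 2≤width) (≤1⇒≤ f≤1 2≤height))
  ... | a , b , a+b≡t , X≡ , Y≡ = a , b , a+b≡t , cong₂ _,_ (recover x₀ X≡) (recover y₀ Y≡)
    where
    lemma : ∀ c w → w ≡ c -ᶻ (c -ᶻ w)
    lemma = solve-∀
    recover : ∀ c {w X} → c -ᶻ w ≡ X → w ≡ c -ᶻ X
    recover c {w} refl = lemma c w

  t₀ : ℕ
  t₀ = t ∸ 1

  t≡1+t₀ : t ≡ suc t₀
  t≡1+t₀ = sym (ℕ.m+[n∸m]≡n 1≤t)

  t₀+1+t≡t+t : t₀ + suc t ≡ t + t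
  t₀+1+t≡t+t = trans (ℕ.+-suc t₀ t) (cong (_+ t) (sym t≡1+t₀))

  back-one : ∀ c k → (c -ᶻ (+ 1 +ᶻ k)) +ᶻ + 1 ≡ c -ᶻ k
  back-one = solve-∀

  two-more : ∀ c k → (c -ᶻ k) -ᶻ + 2 ≡ c -ᶻ (k +ᶻ + 2)
  two-more = solve-∀

  sw-near-corner : ∀ {p q} → p + q ≤ t + t → d (sw p q) (ne 0 0) ≤ t + t
  sw-near-corner {p} {q} p+q≤2t =
    subst (_≤ t + t) (sym (trans (d-sw-ne p q 0 0) (cong₂ _+_ (ℕ.+-identityʳ p) (ℕ.+-identityʳ q)))) p+q≤2t

  -- Two witnesses 2t + 2 apart: one of them lies on the edge of its box facing the corner,
  -- so its box reaches two steps further, to within 2t of the other witness.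
  exceptional : ∀ {K M} → K + M ≡ t → Outside (sw K (suc M + t)) → Outside (sw (suc K + t) M) →
    Reach S (sw K (suc M + t)) (sw (suc K + t) M)
  exceptional {suc K} {M} K+M≡t first second =
    reach-trans first↝arm (close⇒reach P (reach-target first↝arm) (proj₁ second) arm-near)
    where
    east-near : d ((x₀ -ᶻ + suc K) +ᶻ + 1 , y₀ -ᶻ + (suc M + t)) (ne 0 0) ≤ t + t
    east-near = subst (λ x → d (x , y₀ -ᶻ + (suc M + t)) (ne 0 0) ≤ t + t) (sym (back-one x₀ (+ K)))
      (sw-near-corner (ℕ.≤-reflexive (trans (lemma K M t) (cong (_+ t) K+M≡t))))
      where
      lemma : ∀ K M t → K + (suc M + t) ≡ suc K + M + t
      lemma = ℕ-Solver.solve-∀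
    first↝arm : Reach S (sw (suc K) (suc M + t)) (sw (suc K + 2) (suc M + t))
    first↝arm = subst (λ x → Reach S (sw (suc K) (suc M + t)) (x , y₀ -ᶻ + (suc M + t)))
      (two-more x₀ (+ suc K)) (west-arm first east-near)
    arm-near : d (sw (suc K + 2) (suc M + t)) (sw (suc (suc K) + t) M) ≤ t + t
    arm-near = ℕ.≤-reflexive (trans
      (d-sw (trans (cong (λ k → suc (suc K) + k) t≡1+t₀) (lemma K t₀)) (sym (ℕ.+-suc M t)))
      t₀+1+t≡t+t)
      where
      lemma : ∀ K t₀ → suc (suc K) + suc t₀ ≡ (suc K + 2) + t₀
      lemma = ℕ-Solver.solve-∀
  exceptional {zero} refl first second =
    reach-trans (close⇒reach P (proj₁ first) (reach-target second↝arm) arm-near) (reach-sym second↝arm)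
    where
    north-near : d (x₀ -ᶻ + suc t , (y₀ -ᶻ + t) +ᶻ + 1) (ne 0 0) ≤ t + t
    north-near = subst (λ y → d (x₀ -ᶻ + suc t , y) (ne 0 0) ≤ t + t)
      (sym (trans (cong (λ k → (y₀ -ᶻ + k) +ᶻ + 1) t≡1+t₀) (back-one y₀ (+ t₀))))
      (sw-near-corner (ℕ.≤-reflexive (trans (ℕ.+-comm (suc t) t₀) t₀+1+t≡t+t)))
    second↝arm : Reach S (sw (suc t) t) (sw (suc t) (t + 2))
    second↝arm = subst (λ y → Reach S (sw (suc t) t) (x₀ -ᶻ + suc t , y))
      (two-more y₀ (+ t)) (south-arm second north-near)
    arm-near : d (sw 0 (suc t + t)) (sw (suc t) (t + 2)) ≤ t + t
    arm-near = ℕ.≤-reflexive (trans (d-sw {p = 0} {u = suc t} refl (trans (ℕ.+-comm (suc t) t)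
                 (trans (cong (λ k → t + suc k) t≡1+t₀) (sym (ℕ.+-assoc t 2 t₀)))))
               (trans (ℕ.+-comm (suc t) t₀) t₀+1+t≡t+t))

  witness-gap : ∀ {K M a b a' b'} → a + b ≡ t → a' + b' ≡ t →
    ∃[ e ] d (sw (K + a') (suc M + b')) (sw (suc K + a) (M + b)) ≡ e + e × (e ≤ t ⊎ (a' ≡ 0 × a ≡ t))
  witness-gap {K} {M} {a} {b} {a'} {b'} a+b≡t a'+b'≡t with a' ℕ.≤? suc a
  ... | no a'≰1+a with ℕ.m≤n⇒∃[o]m+o≡n (ℕ.<⇒≤ (ℕ.≰⇒> a'≰1+a))
  ...   | e , refl = e , trans (d-sym (sw (K + (suc a + e)) (suc M + b')) (sw (suc K + a) (M + b)))
                               (d-sw (lemma₁ K a e) M+b≡) , inj₁ e≤t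
    where
    lemma₁ : ∀ K a e → K + (suc a + e) ≡ (suc K + a) + e
    lemma₁ = ℕ-Solver.solve-∀
    lemma₂ : ∀ M e b' → M + suc (e + b') ≡ (suc M + b') + e
    lemma₂ = ℕ-Solver.solve-∀
    M+b≡ : M + b ≡ (suc M + b') + e
    M+b≡ = trans (cong (λ k → M + k) (exchange (ℕ.+-suc a e) (trans a+b≡t (sym a'+b'≡t)))) (lemma₂ M e b')
    e≤t : e ≤ t
    e≤t = ℕ.≤-trans (ℕ.m≤n+m e (suc a)) (ℕ.≤-trans (ℕ.m≤m+n (suc a + e) b') (ℕ.≤-reflexive a'+b'≡t))
  witness-gap {K} {M} {a} {b} {a'} {b'} a+b≡t a'+b'≡t | yes a'≤1+a with ℕ.m≤n⇒∃[o]m+o≡n a'≤1+a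
  ... | e , a'+e≡1+a = e , d-sw 1+K+a≡ 1+M+b'≡ , small-or-extreme
    where
    lemma : ∀ M e b → M + (e + b) ≡ (M + b) + e
    lemma = ℕ-Solver.solve-∀
    1+K+a≡ : suc K + a ≡ (K + a') + e
    1+K+a≡ = trans (sym (ℕ.+-suc K a)) (trans (cong (λ k → K + k) (sym a'+e≡1+a)) (sym (ℕ.+-assoc K a' e)))
    1+M+b'≡ : suc M + b' ≡ (M + b) + e
    1+M+b'≡ = trans (sym (ℕ.+-suc M b'))
      (trans (cong (λ k → M + k) (exchange a'+e≡1+a (trans (ℕ.+-suc a' b') (cong suc (trans a'+b'≡t (sym a+b≡t))))))
        (lemma M e b))
    small-or-extreme : e ≤ t ⊎ (a' ≡ 0 × a ≡ t)
    small-or-extreme with e ℕ.≤? t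
    ... | yes e≤t = inj₁ e≤t
    ... | no e≰t = inj₂ (extreme-gap a+b≡t a'+e≡1+a (ℕ.≰⇒> e≰t))

  sw-linked : ∀ {K M a b a' b'} → K + M ≡ t → a + b ≡ t → a' + b' ≡ t →
    Outside (sw (K + a') (suc M + b')) → Outside (sw (suc K + a) (M + b)) →
    Reach S (sw (K + a') (suc M + b')) (sw (suc K + a) (M + b))
  sw-linked {K} {M} {a} {b} {a'} {b'} K+M≡t a+b≡t a'+b'≡t first second with witness-gap {K} {M} a+b≡t a'+b'≡t
  ... | e , distance≡ , inj₁ e≤t =
    close⇒reach P (proj₁ first) (proj₁ second) (subst (_≤ t + t) (sym distance≡) (ℕ.+-mono-≤ e≤t e≤t))
  ... | e , _ , inj₂ (a'≡0 , a≡t) = subst₂ (Reach S) (sym first≡) (sym second≡)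
    (exceptional K+M≡t (subst Outside first≡ first) (subst Outside second≡ second))
    where
    b≡0 : b ≡ 0
    b≡0 = ℕ.+-cancelˡ-≡ t b 0 (trans (cong (_+ b) (sym a≡t)) (trans a+b≡t (sym (ℕ.+-identityʳ t))))
    first≡ : sw (K + a') (suc M + b') ≡ sw K (suc M + t)
    first≡ = cong₂ sw (trans (cong (λ k → K + k) a'≡0) (ℕ.+-identityʳ K))
                      (cong (λ k → suc M + k) (trans (cong (_+ b') (sym a'≡0)) a'+b'≡t))
    second≡ : sw (suc K + a) (M + b) ≡ sw (suc K + t) M
    second≡ = cong₂ sw (cong (λ k → suc K + k) a≡t) (trans (cong (λ k → M + k) b≡0) (ℕ.+-identityʳ M))

  ShapeOf : ℕ → ℕ → Set
  ShapeOf k l = ∃[ a ] ∃[ b ] a + b ≡ t × W k l ≡ sw (k + a) (l + b)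

  linked : ∀ {K M} → K + M ≡ t → Reach S (W K (suc M)) (W (suc K) M)
  linked {K} {M} K+M≡t = link (W-shape K (suc M) K+1+M≡1+t) (W-shape (suc K) M 1+K+M≡1+t)
    where
    K+1+M≡1+t : K + suc M ≡ suc t
    K+1+M≡1+t = trans (ℕ.+-suc K M) (cong suc K+M≡t)
    1+K+M≡1+t : suc K + M ≡ suc t
    1+K+M≡1+t = cong suc K+M≡t
    link : ShapeOf K (suc M) → ShapeOf (suc K) M → Reach S (W K (suc M)) (W (suc K) M)
    link (a' , b' , a'+b'≡t , W₁≡) (a , b , a+b≡t , W₂≡) = subst₂ (Reach S) (sym W₁≡) (sym W₂≡)
      (sw-linked {K} {M} {a} {b} {a'} {b'} K+M≡t a+b≡t a'+b'≡t
        (subst Outside W₁≡ (W-outside K (suc M) K+1+M≡1+t)) (subst Outside W₂≡ (W-outside (suc K) M 1+K+M≡1+t)))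

  chain : ∀ K M → K + M ≡ suc t → Reach S (W 0 (suc t)) (W K M)
  chain zero _ refl = here (proj₁ (W-outside 0 (suc t) refl))
  chain (suc K) M 1+K+M≡1+t =
    reach-trans (chain K (suc M) (trans (ℕ.+-suc K M) 1+K+M≡1+t)) (linked (ℕ.suc-injective 1+K+M≡1+t))

  impossible : ⊥
  impossible = from-corners (W-shape 0 (suc t) refl) (W-shape (suc t) 0 (ℕ.+-identityʳ (suc t)))
    where
    W₀-outside : Outside (W 0 (suc t))
    W₀-outside = W-outside 0 (suc t) refl
    from-corners : ShapeOf 0 (suc t) → ShapeOf (suc t) 0 → ⊥
    from-corners (a₀ , b₀ , a₀+b₀≡t , W₀≡) (a₁ , b₁ , a₁+b₁≡t , W₁≡) =
      proj₂ W₀-outside (reach-trans (near-corner (reach-target W₀↝corner) corner-near) (reach-sym W₀↝corner))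
      where
      W₀↝corner : Reach S (W 0 (suc t)) (sw a₀ b₁)
      W₀↝corner = box-corner (box (proj₁ W₀-outside))
        (subst (Reach S (W 0 (suc t))) W₀≡ (here (proj₁ W₀-outside)))
        (subst (Reach S (W 0 (suc t))) W₁≡ (chain (suc t) 0 (ℕ.+-identityʳ (suc t))))
      corner-near : d (sw a₀ b₁) (ne 0 0) ≤ t + t
      corner-near = sw-near-corner
        (ℕ.+-mono-≤ (subst (a₀ ≤_) a₀+b₀≡t (ℕ.m≤m+n a₀ b₀)) (subst (b₁ ≤_) a₁+b₁≡t (ℕ.m≤n+m b₁ a₁)))

theorem3 : (s r t : ℕ) → 3 ≤ s → s ≤ r → 1 ≤ t →
    (S : VSet) → ¬ PDDS[Grid] t s r S
theorem3 s r t 3≤s s≤r 1≤t S (P , grids) =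
  Corner.impossible 1≤t P (λ Su → component-box 3≤s (ℕ.≤-trans 3≤s s≤r) (grids _ Su))
    (proj₁ (proj₂ (covered P 0ᵛ)))
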